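{- Let $a$ be a positive integer and let $(e(n))_{n\ge 0}$ be defined by $e(0)=0$, $e(1)=1$, $e(n)=a\,e(n-1)+e(n-2)$ for $n\ge 2$. Then for all nonnegative integers $i,j$, $$e(2(i+j)+2)=\frac{e(2j+1)}{2}\sqrt{e(2i+1)^{2}(a^{2}+4)-4}+\frac{e(2i+1)}{2}\sqrt{e(2j+1)^{2}(a^{2}+4)-4}.$$ -}

module Defs where

open import Data.Nat using (ℕ; zero; suc; _+_; _*_)

e : ℕ → ℕ → ℕ
e a zero = 0
e a (suc zero) = 1
e a (suc (suc n)) = a * e a (suc n) + e a n

-- Since e(n+2) = a e(n+1) + e(n), the Cassini quantity e(n+1)² − e(n)e(n+2) changes sign
-- from one index to the next, so it equals 1 at every even n.  For such n the companion
-- term s = e(n) + e(n+2) satisfies s² + 4 = e(n+1)²(a² + 4), i.e. s is the square root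
-- in the statement.  The identity itself comes from expanding e(p+q+2) by the addition
-- formula e(m+n+1) = e(m+1)e(n+1) + e(m)e(n) in two ways and adding the results.
module Submission where

open import Defs
open import Data.Nat using (ℕ; zero; suc; _+_; _*_; _∸_; _^_; _≤_)
open import Data.Nat.Properties using (+-comm; +-suc; *-suc; *-distribˡ-+; m+n∸n≡m)
open import Data.Nat.Tactic.RingSolver using (solve-∀)
open import Data.Nat.Solver using (module +-*-Solver)
open +-*-Solver using (solve; _:+_; _:*_; _:^_; _:=_; con)
open import Data.Product using (∃₂; _×_; _,_)
open import Relation.Binary.PropositionalEquality
  using (_≡_; refl; sym; trans; cong; cong₂; subst; module ≡-Reasoning)
open ≡-Reasoning

module _ (a : ℕ) where

  e-+1 : ∀ n → e a (n + 1) ≡ e a (suc n)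
  e-+1 n = cong (e a) (+-comm n 1)

  e-addition : ∀ m n → e a (m + n + 1) ≡ e a (suc m) * e a (suc n) + e a m * e a n
  e-addition zero n = trans (e-+1 n) (y≡1*y+0*x (e a (suc n)) (e a n))
    where
    y≡1*y+0*x : ∀ y x → y ≡ 1 * y + 0 * x
    y≡1*y+0*x = solve-∀
  e-addition (suc m) n = begin
    e a (suc m + n + 1)   ≡⟨ cong (λ k → e a (k + 1)) (sym (+-suc m n)) ⟩
    e a (m + suc n + 1)   ≡⟨ e-addition m (suc n) ⟩
    e a (suc m) * (a * e a (suc n) + e a n) + e a m * e a (suc n)
      ≡⟨ regroup a (e a (suc m)) (e a m) (e a (suc n)) (e a n) ⟩
    (a * e a (suc m) + e a m) * e a (suc n) + e a (suc m) * e a n ∎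
    where
    regroup : ∀ a p q r s → p * (a * r + s) + q * r ≡ (a * p + q) * r + p * s
    regroup = solve-∀

  cassini-surplus⇒deficit : ∀ n c → e a (suc n) * e a (suc n) ≡ e a n * e a (2 + n) + c →
                  e a (suc n) * e a (3 + n) ≡ e a (2 + n) * e a (2 + n) + c
  cassini-surplus⇒deficit n c yy≡xz+c = begin
    y * (a * z + y)         ≡⟨ expand a y z y ⟩
    a * y * z + y * y       ≡⟨ cong (a * y * z +_) yy≡xz+c ⟩
    a * y * z + (x * z + c) ≡⟨ collapse a x y z c ⟩
    z * (a * y + x) + c ∎
    where
    x y z : ℕ
    x = e a n
    y = e a (suc n)
    z = e a (2 + n)
    expand : ∀ a u v t → u * (a * v + t) ≡ a * u * v + u * t
    expand = solve-∀
    collapse : ∀ a x y z c → a * y * z + (x * z + c) ≡ z * (a * y + x) + c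
    collapse = solve-∀

  cassini-deficit⇒surplus : ∀ n c → e a n * e a (2 + n) ≡ e a (suc n) * e a (suc n) + c →
                  e a (2 + n) * e a (2 + n) ≡ e a (suc n) * e a (3 + n) + c
  cassini-deficit⇒surplus n c xz≡yy+c = begin
    z * (a * y + x)         ≡⟨ expand a z y x ⟩
    a * z * y + z * x       ≡⟨ cong (a * z * y +_) (trans (commute z x) xz≡yy+c) ⟩
    a * z * y + (y * y + c) ≡⟨ collapse a y z c ⟩
    y * (a * z + y) + c ∎
    where
    x y z : ℕ
    x = e a n
    y = e a (suc n)
    z = e a (2 + n)
    expand : ∀ a u v t → u * (a * v + t) ≡ a * u * v + u * t
    expand = solve-∀
    commute : ∀ u v → u * v ≡ v * u
    commute = solve-∀
    collapse : ∀ a y z c → a * z * y + (y * y + c) ≡ y * (a * z + y) + c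
    collapse = solve-∀

  cassini-even : ∀ k → e a (suc (2 * k)) * e a (suc (2 * k)) ≡ e a (2 * k) * e a (2 + 2 * k) + 1
  cassini-even zero = refl
  cassini-even (suc k) = subst Cassini (sym (*-suc 2 k))
    (cassini-deficit⇒surplus (suc (2 * k)) 1 (cassini-surplus⇒deficit (2 * k) 1 (cassini-even k)))
    where
    Cassini : ℕ → Set
    Cassini n = e a (suc n) * e a (suc n) ≡ e a n * e a (2 + n) + 1

  companion : ℕ → ℕ
  companion n = e a n + e a (2 + n)

  companion-square : ∀ n c → e a (suc n) * e a (suc n) ≡ e a n * e a (2 + n) + c →
                     companion n ^ 2 + 4 * c ≡ e a (suc n) ^ 2 * (a ^ 2 + 4)
  companion-square n c yy≡xz+c = begin
    (x + (a * y + x)) ^ 2 + 4 * c                ≡⟨ expand a x y c ⟩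
    a ^ 2 * (y * y) + 4 * (x * (a * y + x) + c)  ≡⟨ cong (λ t → a ^ 2 * (y * y) + 4 * t) (sym yy≡xz+c) ⟩
    a ^ 2 * (y * y) + 4 * (y * y)                ≡⟨ collect a y ⟩
    y ^ 2 * (a ^ 2 + 4) ∎
    where
    x y : ℕ
    x = e a n
    y = e a (suc n)
    expand : ∀ a x y c → (x + (a * y + x)) ^ 2 + 4 * c ≡ a ^ 2 * (y * y) + 4 * (x * (a * y + x) + c)
    expand = solve 4 (λ a x y c → (x :+ (a :* y :+ x)) :^ 2 :+ con 4 :* c
                                 := a :^ 2 :* (y :* y) :+ con 4 :* (x :* (a :* y :+ x) :+ c)) refl
    collect : ∀ a y → a ^ 2 * (y * y) + 4 * (y * y) ≡ y ^ 2 * (a ^ 2 + 4)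
    collect = solve 2 (λ a y → a :^ 2 :* (y :* y) :+ con 4 :* (y :* y) := y :^ 2 :* (a :^ 2 :+ con 4)) refl

  companion-identity : ∀ p q → 2 * e a (2 + (p + q)) ≡ e a (suc q) * companion p + e a (suc p) * companion q
  companion-identity p q = begin
    2 * e a (2 + (p + q))                  ≡⟨ double (e a (2 + (p + q))) ⟩
    e a (2 + (p + q)) + e a (2 + (p + q))  ≡⟨ cong₂ _+_ (trans (cong (e a) p+1+q+1) (e-addition (suc p) q))
                                                        (trans (cong (e a) p+q+1+1) (e-addition p (suc q))) ⟩
    (e a (2 + p) * e a (suc q) + e a (suc p) * e a q) + (e a (suc p) * e a (2 + q) + e a p * e a (suc q))
      ≡⟨ regroup (e a p) (e a (suc p)) (e a (2 + p)) (e a q) (e a (suc q)) (e a (2 + q)) ⟩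
    e a (suc q) * (e a p + e a (2 + p)) + e a (suc p) * (e a q + e a (2 + q)) ∎
    where
    double : ∀ t → 2 * t ≡ t + t
    double = solve-∀
    p+1+q+1 : 2 + (p + q) ≡ suc p + q + 1
    p+1+q+1 = +-comm 1 (suc p + q)
    p+q+1+1 : 2 + (p + q) ≡ p + suc q + 1
    p+q+1+1 = trans (cong suc (sym (+-suc p q))) (+-comm 1 (p + suc q))
    regroup : ∀ p₀ p₁ p₂ q₀ q₁ q₂ →
      (p₂ * q₁ + p₁ * q₀) + (p₁ * q₂ + p₀ * q₁) ≡ q₁ * (p₀ + p₂) + p₁ * (q₀ + q₂)
    regroup = solve-∀

  companion-root : ∀ i → companion (2 * i) ^ 2 ≡ e a (2 * i + 1) ^ 2 * (a ^ 2 + 4) ∸ 4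
  companion-root i = begin
    companion (2 * i) ^ 2                    ≡⟨ sym (m+n∸n≡m _ 4) ⟩
    companion (2 * i) ^ 2 + 4 ∸ 4            ≡⟨ cong (_∸ 4) (companion-square (2 * i) 1 (cassini-even i)) ⟩
    e a (suc (2 * i)) ^ 2 * (a ^ 2 + 4) ∸ 4  ≡⟨ cong (λ y → y ^ 2 * (a ^ 2 + 4) ∸ 4) (sym (e-+1 (2 * i))) ⟩
    e a (2 * i + 1) ^ 2 * (a ^ 2 + 4) ∸ 4 ∎

theorem7 : (a : ℕ) → 1 ≤ a → (i j : ℕ) →
    ∃₂ λ s t →
      (s ^ 2 ≡ (e a (2 * i + 1)) ^ 2 * (a ^ 2 + 4) ∸ 4) ×
      (t ^ 2 ≡ (e a (2 * j + 1)) ^ 2 * (a ^ 2 + 4) ∸ 4) ×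
      (2 * e a (2 * (i + j) + 2) ≡ e a (2 * j + 1) * s + e a (2 * i + 1) * t)
theorem7 a _ i j =
  companion a (2 * i) , companion a (2 * j) , companion-root a i , companion-root a j , identity
  where
  index : 2 * (i + j) + 2 ≡ 2 + (2 * i + 2 * j)
  index = trans (+-comm (2 * (i + j)) 2) (cong (2 +_) (*-distribˡ-+ 2 i j))
  identity : 2 * e a (2 * (i + j) + 2) ≡
             e a (2 * j + 1) * companion a (2 * i) + e a (2 * i + 1) * companion a (2 * j)
  identity = begin
    2 * e a (2 * (i + j) + 2)      ≡⟨ cong (λ n → 2 * e a n) index ⟩
    2 * e a (2 + (2 * i + 2 * j))  ≡⟨ companion-identity a (2 * i) (2 * j) ⟩
    e a (suc (2 * j)) * companion a (2 * i) + e a (suc (2 * i)) * companion a (2 * j)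
      ≡⟨ sym (cong₂ (λ u v → u * companion a (2 * i) + v * companion a (2 * j)) (e-+1 a (2 * j)) (e-+1 a (2 * i))) ⟩
    e a (2 * j + 1) * companion a (2 * i) + e a (2 * i + 1) * companion a (2 * j) ∎
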